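{- If $L$ is accepted by a DFA with $n$ states and $L$ is not prefix-free, then there exists a witness $(v,w)$ to the failure of prefix-freeness with $|w| \le 2n-1$. The bound is best possible: for every $n \ge 1$ there is a DFA with $n$ states whose language is not prefix-free and every witness $(v,w)$ of which satisfies $|w| \ge 2n-1$.
   Context: A word $v$ is a prefix of $w$ if $w = vx$ for some word $x$. $L$ is prefix-free if no word of $L$ has a proper prefix (a prefix different from itself) in $L$. A witness to the failure of prefix-freeness is a pair $(v,w)$ with $v,w \in L$, $v$ a prefix of $w$ and $v \neq w$. -}

module Defs where

open import Data.Nat using (ℕ)
open import Data.Empty using (⊥)
open import Data.Fin using (Fin)
open import Data.Bool using (Bool; true)
open import Data.List using (List; []; _∷_; _++_; length)
open import Data.Product using (Σ; ∃; _×_)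
open import Relation.Binary.PropositionalEquality using (_≡_; _≢_)

record DFA (n k : ℕ) : Set where
  field
    δ      : Fin n → Fin k → Fin n
    start  : Fin n
    accept : Fin n → Bool

Word : ℕ → Set
Word k = List (Fin k)

δ* : ∀ {n k} → DFA n k → Fin n → Word k → Fin n
δ* D q []       = q
δ* D q (a ∷ w)  = δ* D (DFA.δ D q a) w

Accepts : ∀ {n k} → DFA n k → Word k → Set
Accepts D w = DFA.accept D (δ* D (DFA.start D) w) ≡ true

IsPrefix : ∀ {k} → Word k → Word k → Set
IsPrefix v w = Σ _ λ x → w ≡ v ++ x

Witness : ∀ {n k} → DFA n k → Word k → Word k → Set
Witness D v w = Accepts D v × Accepts D w × IsPrefix v w × v ≢ w

PrefixFree : ∀ {n k} → DFA n k → Set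
PrefixFree D = ∀ v w → Witness D v w → ⊥

-- Upper bound: in a witness (v , v ++ a ∷ x) only the states reached after v and
-- after v ++ [ a ] matter, and by pigeonhole every state reachable by some word is
-- reachable by a word of length < n; so v and x can both be shortened below n,
-- giving |w| ≤ (n - 1) + 1 + (n - 1). Since this shortening makes the existence of a
-- witness equivalent to a bounded, hence decidable, search, a witness can be
-- extracted constructively from ¬ PrefixFree.
--
-- Lower bound: the unary automaton counting modulo n and accepting exactly the words
-- of length ≡ n - 1 (mod n). In a witness (v , v ++ a ∷ x) both v and x are accepted,
-- so each has length ≥ n - 1.
module Submission where

open import Defs
open import Data.Nat using (ℕ; _≤_; _*_; _∸_; _≥_)
open import Data.List using (length)
open import Data.Product using (Σ; _×_)
open import Relation.Nullary using (¬_)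

open import Data.Nat using (NonZero; zero; suc; _+_; _<_; _⊓_; _%_; _≡ᵇ_; z≤n; s≤s; _≤?_)
open import Data.Nat.Properties
  using (≤-refl; ≤-trans; ≤-pred; ≰⇒>; n≤0⇒n≡0; +-identityʳ; +-suc; +-comm; +-mono-≤; +-monoˡ-≤; +-monoˡ-<;
         m⊓n≤m; m+[n∸m]≡n; ≡ᵇ⇒≡; ≡⇒≡ᵇ; module ≤-Reasoning)
open import Data.Nat.DivMod using (_mod_; m≤n⇒m%n≡m; m%n<n; m%n≤m; m<n⇒m%n≡m; m%n%n≡m%n; %-distribˡ-+; [m+n]%n≡m%n)
open import Data.List using ([]; _∷_; _++_; take; drop; replicate)
open import Data.List.Properties
  using (length-take; length-drop; take++drop≡id; length-++; length-replicate; ++-identityʳ; ++-identityʳ-unique)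
open import Data.Fin using (Fin; toℕ; fromℕ<)
open import Data.Fin.Patterns using (0F)
open import Data.Fin.Properties using (pigeonhole; any?; toℕ<n; toℕ-fromℕ<)
open import Data.Bool.Properties using (T-≡; _≟_)
open import Data.Product using (∃-syntax; _,_)
open import Data.Empty using (⊥-elim)
open import Function using (_∘_; _⇔_; mk⇔; Equivalence)
open import Relation.Nullary using (Dec; yes; no; _×-dec_)
open import Relation.Nullary.Decidable using (decidable-stable)
open import Relation.Unary using (Decidable)
open import Relation.Binary.PropositionalEquality

private
  variable
    n k : ℕ

δ*-++ : (D : DFA n k) → ∀ q u x → δ* D q (u ++ x) ≡ δ* D (δ* D q u) x
δ*-++ D q []      x = refl
δ*-++ D q (a ∷ u) x = δ*-++ D (DFA.δ D q a) u x

δ*-congˡ-++ : (D : DFA n k) → ∀ q u u′ x → δ* D q u ≡ δ* D q u′ → δ* D q (u ++ x) ≡ δ* D q (u′ ++ x)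
δ*-congˡ-++ D q u u′ x eq = begin
  δ* D q (u ++ x)       ≡⟨ δ*-++ D q u x ⟩
  δ* D (δ* D q u) x     ≡⟨ cong (λ s → δ* D s x) eq ⟩
  δ* D (δ* D q u′) x    ≡⟨ δ*-++ D q u′ x ⟨
  δ* D q (u′ ++ x)      ∎
  where open ≡-Reasoning

witness⇒∷-extension : (D : DFA n k) {v w : Word k} → Witness D v w → ∃[ a ] ∃[ x ] w ≡ v ++ a ∷ x
witness⇒∷-extension D {v} (_ , _ , ([] , w≡v++[]) , v≢w) =
  ⊥-elim (v≢w (sym (trans w≡v++[] (++-identityʳ v))))
witness⇒∷-extension D (_ , _ , (a ∷ x , w≡v++a∷x) , _) = a , x , w≡v++a∷x

m+1+o≤2n∸1 : ∀ {m n o} → m < n → o < n → m + suc o ≤ 2 * n ∸ 1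
m+1+o≤2n∸1 {m} {suc n} {o} (s≤s m≤n) o<1+n = begin
  m + suc o     ≤⟨ +-mono-≤ m≤n o<1+n ⟩
  n + suc n     ≡⟨ cong (λ t → n + suc t) (+-identityʳ n) ⟨
  2 * suc n ∸ 1 ∎
  where open ≤-Reasoning

∷-extension⇒witness : (D : DFA n k) {v x : Word k} {a : Fin k} →
                      Accepts D v → Accepts D (v ++ a ∷ x) → Witness D v (v ++ a ∷ x)
∷-extension⇒witness D {v} acc-v acc-w = acc-v , acc-w , (_ , refl) , v≢w
  where
    v≢w : v ≢ v ++ _
    v≢w v≡w with () ← ++-identityʳ-unique v v≡w

[m%d+n]%d≡[m+n]%d : ∀ m n d .{{_ : NonZero d}} → (m % d + n) % d ≡ (m + n) % d
[m%d+n]%d≡[m+n]%d m n d = begin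
  (m % d + n) % d         ≡⟨ %-distribˡ-+ (m % d) n d ⟩
  (m % d % d + n % d) % d ≡⟨ cong (λ t → (t + n % d) % d) (m%n%n≡m%n m d) ⟩
  (m % d + n % d) % d     ≡⟨ %-distribˡ-+ m n d ⟨
  (m + n) % d             ∎
  where open ≡-Reasoning

any-word<? : {P : Word k → Set} → Decidable P → ∀ b → Dec (∃[ w ] length w < b × P w)
any-word<? P? zero = no λ ()
any-word<? P? (suc b) with P? [] | any? (λ a → any-word<? (P? ∘ (a ∷_)) b)
... | yes p | _ = yes ([] , s≤s z≤n , p)
... | no _  | yes (a , w , |w|<b , p) = yes (a ∷ w , s≤s |w|<b , p)
... | no ¬p | no ¬q = no λ where
  ([] , _ , p)               → ¬p p
  (a ∷ w , s≤s |w|<b , p)    → ¬q (a , w , |w|<b , p)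

module UpperBound (D : DFA n k) where
  open DFA D

  accepts? : Decidable (Accepts D)
  accepts? w = accept (δ* D start w) ≟ _

  -- Two of the n + 1 prefixes of u of length ≤ n reach the same state; cut out the
  -- factor between them.
  pumping-down : ∀ q u → n ≤ length u → ∃[ u′ ] length u′ < length u × δ* D q u′ ≡ δ* D q u
  pumping-down q u n≤|u| with pigeonhole ≤-refl (λ (i : Fin (suc n)) → δ* D q (take (toℕ i) u))
  ... | i , j , i<j , same = take (toℕ i) u ++ drop (toℕ j) u , shorter , sym same-state
    where
      L = length u
      j≤L : toℕ j ≤ L
      j≤L = ≤-trans (≤-pred (toℕ<n j)) n≤|u|
      shorter : length (take (toℕ i) u ++ drop (toℕ j) u) < L
      shorter = begin-strict
        length (take (toℕ i) u ++ drop (toℕ j) u)   ≡⟨ length-++ (take (toℕ i) u) ⟩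
        length (take (toℕ i) u) + length (drop (toℕ j) u)
          ≡⟨ cong₂ _+_ (length-take (toℕ i) u) (length-drop (toℕ j) u) ⟩
        toℕ i ⊓ L + (L ∸ toℕ j)                      ≤⟨ +-monoˡ-≤ (L ∸ toℕ j) (m⊓n≤m (toℕ i) L) ⟩
        toℕ i + (L ∸ toℕ j)                          <⟨ +-monoˡ-< (L ∸ toℕ j) i<j ⟩
        toℕ j + (L ∸ toℕ j)                          ≡⟨ m+[n∸m]≡n j≤L ⟩
        L                                            ∎
        where open ≤-Reasoning
      same-state : δ* D q u ≡ δ* D q (take (toℕ i) u ++ drop (toℕ j) u)
      same-state = begin
        δ* D q u                                 ≡⟨ cong (δ* D q) (take++drop≡id (toℕ j) u) ⟨
        δ* D q (take (toℕ j) u ++ drop (toℕ j) u)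
          ≡⟨ δ*-congˡ-++ D q (take (toℕ j) u) (take (toℕ i) u) (drop (toℕ j) u) (sym same) ⟩
        δ* D q (take (toℕ i) u ++ drop (toℕ j) u) ∎
        where open ≡-Reasoning

  reachable-by-short-word-≤ : ∀ b q u → length u ≤ b → ∃[ u′ ] length u′ < n × δ* D q u′ ≡ δ* D q u
  reachable-by-short-word-≤ b q u |u|≤b with n ≤? length u
  ... | no n≰|u| = u , ≰⇒> n≰|u| , refl
  reachable-by-short-word-≤ zero q u |u|≤0 | yes n≤|u| with () ← subst Fin (n≤0⇒n≡0 (≤-trans n≤|u| |u|≤0)) q
  reachable-by-short-word-≤ (suc b) q u |u|≤1+b | yes n≤|u|
    with u′ , |u′|<|u| , eq ← pumping-down q u n≤|u|
    with u″ , |u″|<n , eq′ ← reachable-by-short-word-≤ b q u′ (≤-pred (≤-trans |u′|<|u| |u|≤1+b))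
    = u″ , |u″|<n , trans eq′ eq

  reachable-by-short-word : ∀ q u → ∃[ u′ ] length u′ < n × δ* D q u′ ≡ δ* D q u
  reachable-by-short-word q u = reachable-by-short-word-≤ (length u) q u ≤-refl

  ShortWitness : Set
  ShortWitness = ∃[ v ] length v < n × Accepts D v × ∃[ a ] ∃[ x ] length x < n × Accepts D (v ++ a ∷ x)

  shortWitness? : Dec ShortWitness
  shortWitness? = any-word<? (λ v → accepts? v ×-dec any? λ a → any-word<? (accepts? ∘ (v ++_) ∘ (a ∷_)) n) n

  witness⇒shortWitness : ∀ {v w} → Witness D v w → ShortWitness
  witness⇒shortWitness {v} wit@(acc-v , acc-w , _)
    with a , x , refl ← witness⇒∷-extension D wit
    with v′ , |v′|<n , v′∼v ← reachable-by-short-word start v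
    with x′ , |x′|<n , x′∼x ← reachable-by-short-word (δ (δ* D start v) a) x
    = v′ , |v′|<n , trans (cong accept v′∼v) acc-v , a , x′ , |x′|<n , trans (cong accept w′∼w) acc-w
    where
      w′∼w : δ* D start (v′ ++ a ∷ x′) ≡ δ* D start (v ++ a ∷ x)
      w′∼w = begin
        δ* D start (v′ ++ a ∷ x′)          ≡⟨ δ*-congˡ-++ D start v′ v (a ∷ x′) v′∼v ⟩
        δ* D start (v ++ a ∷ x′)           ≡⟨ δ*-++ D start v (a ∷ x′) ⟩
        δ* D (δ (δ* D start v) a) x′       ≡⟨ x′∼x ⟩
        δ* D (δ (δ* D start v) a) x        ≡⟨ δ*-++ D start v (a ∷ x) ⟨
        δ* D start (v ++ a ∷ x)            ∎
        where open ≡-Reasoning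

  shortWitness⇒witness : ShortWitness → ∃[ v ] ∃[ w ] Witness D v w × length w ≤ 2 * n ∸ 1
  shortWitness⇒witness (v , |v|<n , acc-v , a , x , |x|<n , acc-w) =
    v , v ++ a ∷ x , ∷-extension⇒witness D acc-v acc-w ,
    subst (_≤ 2 * n ∸ 1) (sym (length-++ v)) (m+1+o≤2n∸1 |v|<n |x|<n)

  short-witness : ¬ PrefixFree D → ∃[ v ] ∃[ w ] Witness D v w × length w ≤ 2 * n ∸ 1
  short-witness ¬pf = shortWitness⇒witness (decidable-stable shortWitness? λ ¬short →
    ¬pf λ _ _ → ¬short ∘ witness⇒shortWitness)

module Counter (m : ℕ) where
  counter : DFA (suc m) 1
  counter = record
    { δ      = λ q _ → suc (toℕ q) mod suc m
    ; start  = 0F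
    ; accept = λ q → toℕ q ≡ᵇ m
    }

  open Equivalence using (to; from)

  toℕ-δ* : ∀ q u → toℕ (δ* counter q u) ≡ (toℕ q + length u) % suc m
  toℕ-δ* q []      = sym (trans (cong (_% suc m) (+-identityʳ (toℕ q))) (m<n⇒m%n≡m (toℕ<n q)))
  toℕ-δ* q (a ∷ u) = begin
    toℕ (δ* counter (suc (toℕ q) mod suc m) u)         ≡⟨ toℕ-δ* _ u ⟩
    (toℕ (suc (toℕ q) mod suc m) + length u) % suc m
      ≡⟨ cong (λ t → (t + length u) % suc m) (toℕ-fromℕ< (m%n<n (suc (toℕ q)) (suc m))) ⟩
    (suc (toℕ q) % suc m + length u) % suc m           ≡⟨ [m%d+n]%d≡[m+n]%d (suc (toℕ q)) (length u) (suc m) ⟩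
    (suc (toℕ q) + length u) % suc m                   ≡⟨ cong (_% suc m) (+-suc (toℕ q) (length u)) ⟨
    (toℕ q + suc (length u)) % suc m                   ∎
    where open ≡-Reasoning

  accepts⇔ : ∀ u → Accepts counter u ⇔ length u % suc m ≡ m
  accepts⇔ u = mk⇔
    (λ acc → trans (sym (toℕ-δ* _ u)) (≡ᵇ⇒≡ _ m (from T-≡ acc)))
    (λ |u|%≡m → to T-≡ (≡⇒≡ᵇ _ m (trans (toℕ-δ* _ u) |u|%≡m)))

  accepted⇒m≤length : ∀ u → Accepts counter u → m ≤ length u
  accepted⇒m≤length u acc = subst (_≤ length u) (to (accepts⇔ u) acc) (m%n≤m (length u) (suc m))

  a%d≡m⇒[a+1+b]%d≡b%d : ∀ a b → a % suc m ≡ m → (a + suc b) % suc m ≡ b % suc m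
  a%d≡m⇒[a+1+b]%d≡b%d a b a%d≡m = begin
    (a + suc b) % suc m          ≡⟨ [m%d+n]%d≡[m+n]%d a (suc b) (suc m) ⟨
    (a % suc m + suc b) % suc m  ≡⟨ cong (λ t → (t + suc b) % suc m) a%d≡m ⟩
    (m + suc b) % suc m          ≡⟨ cong (_% suc m) (trans (+-suc m b) (+-comm (suc m) b)) ⟩
    (b + suc m) % suc m          ≡⟨ [m+n]%n≡m%n b (suc m) ⟩
    b % suc m                    ∎
    where open ≡-Reasoning

  accepts-∷-extension⇔ : ∀ v a x → Accepts counter v → Accepts counter (v ++ a ∷ x) ⇔ Accepts counter x
  accepts-∷-extension⇔ v a x acc-v = mk⇔
    (λ acc-w → from (accepts⇔ x) (trans (sym (|w|%≡|x|%)) (to (accepts⇔ (v ++ a ∷ x)) acc-w)))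
    (λ acc-x → from (accepts⇔ (v ++ a ∷ x)) (trans |w|%≡|x|% (to (accepts⇔ x) acc-x)))
    where
      |w|%≡|x|% : length (v ++ a ∷ x) % suc m ≡ length x % suc m
      |w|%≡|x|% = trans (cong (_% suc m) (length-++ v))
                        (a%d≡m⇒[a+1+b]%d≡b%d (length v) (length x) (to (accepts⇔ v) acc-v))

  witness⇒length≥2n∸1 : ∀ {v w} → Witness counter v w → 2 * suc m ∸ 1 ≤ length w
  witness⇒length≥2n∸1 {v} wit@(acc-v , acc-w , _) with a , x , refl ← witness⇒∷-extension counter wit = begin
    2 * suc m ∸ 1              ≡⟨ cong (λ t → m + suc t) (+-identityʳ m) ⟩
    m + suc m                  ≤⟨ +-mono-≤ (accepted⇒m≤length v acc-v) (s≤s (accepted⇒m≤length x acc-x)) ⟩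
    length v + suc (length x)  ≡⟨ length-++ v ⟨
    length (v ++ a ∷ x)        ∎
    where
      open ≤-Reasoning
      acc-x : Accepts counter x
      acc-x = to (accepts-∷-extension⇔ v a x acc-v) acc-w

  not-prefixFree : ¬ PrefixFree counter
  not-prefixFree pf = pf v (v ++ 0F ∷ v) (∷-extension⇒witness counter acc-v acc-w)
    where
      v : Word 1
      v = replicate m 0F
      acc-v : Accepts counter v
      acc-v = from (accepts⇔ v) (trans (cong (_% suc m) (length-replicate m)) (m≤n⇒m%n≡m ≤-refl))
      acc-w : Accepts counter (v ++ 0F ∷ v)
      acc-w = from (accepts-∷-extension⇔ v 0F v acc-v) acc-v

theorem12 : ((n k : ℕ) (D : DFA n k) → ¬ PrefixFree D →
               Σ (Word k) λ v → Σ (Word k) λ w → Witness D v w × length w ≤ 2 * n ∸ 1)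
            × ((n : ℕ) → n ≥ 1 →
               Σ ℕ λ k → Σ (DFA n k) λ D → ¬ PrefixFree D ×
                 ((v w : Word k) → Witness D v w → length w ≥ 2 * n ∸ 1))
theorem12 = (λ n k D → UpperBound.short-witness D) , λ where
  (suc m) _ → 1 , Counter.counter m , Counter.not-prefixFree m , λ _ _ → Counter.witness⇒length≥2n∸1 m
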